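{- Let $A,B$ be two microCCS processes that are normal forms with respect to $\rightarrow_d$. If $A\sim B$ then $A\equiv B$.
   Context: MicroCCS processes: $\eta ::= a \mid \overline{a}$ (names $a$), $P ::= \mathbf{0} \mid \eta.P \mid P|Q$. Structural congruence $\equiv$: smallest congruence with $P|Q\equiv Q|P$, $P|(Q|R)\equiv(P|Q)|R$, $P|\mathbf 0\equiv P$. Transitions: $\eta.P\xrightarrow{\eta}P$; if $P\xrightarrow{\eta}P'$, $Q\xrightarrow{\overline\eta}Q'$ then $P|Q\xrightarrow{\tau}P'|Q'$; if $P\xrightarrow{\mu}P'$ then $P|Q\xrightarrow{\mu}P'|Q$ and $Q|P\xrightarrow{\mu}Q|P'$. Strong bisimilarity $\sim$ is the union of all symmetric relations $\mathcal R$ such that $P\mathcal RQ$, $P\xrightarrow{\mu}P'$ imply $Q\xrightarrow{\mu}Q'$ with $P'\mathcal RQ'$. $R^k$ is the $k$-fold parallel composition of $R$. $P\rightarrow_d P'$ holds when there are $P_1,P_2$ with $P\equiv P_1$, $P_2\equiv P'$ and $P_2$ obtained from $P_1$ by replacing a subterm $\eta.(R|(\eta.R)^k)$, $k\geq1$, by $(\eta.R)^{k+1}$. A normal form is a process with no $\rightarrow_d$-successor. -}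

module Defs where

open import Data.Nat using (ℕ; zero; suc)
open import Data.Product using (Σ; _×_; ∃; ∃-syntax; _,_)
open import Relation.Nullary using (¬_)
open import Level using (Level) renaming (suc to lsuc)

Name : Set
Name = ℕ

data Prefix : Set where
  inp : Name → Prefix
  out : Name → Prefix

co : Prefix → Prefix
co (inp a) = out a
co (out a) = inp a

infixr 7 _∙_
infixl 6 _∣_
data Proc : Set where
  𝟘   : Proc
  _∙_ : Prefix → Proc → Proc
  _∣_ : Proc → Proc → Proc

infix 4 _≡ₛ_
data _≡ₛ_ : Proc → Proc → Set where
  ≡-refl  : ∀ {P} → P ≡ₛ P
  ≡-sym   : ∀ {P Q} → P ≡ₛ Q → Q ≡ₛ P
  ≡-trans : ∀ {P Q R} → P ≡ₛ Q → Q ≡ₛ R → P ≡ₛ R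
  ≡-pre   : ∀ {η P Q} → P ≡ₛ Q → η ∙ P ≡ₛ η ∙ Q
  ≡-par   : ∀ {P P' Q Q'} → P ≡ₛ P' → Q ≡ₛ Q' → P ∣ Q ≡ₛ P' ∣ Q'
  ≡-comm  : ∀ {P Q} → P ∣ Q ≡ₛ Q ∣ P
  ≡-assoc : ∀ {P Q R} → P ∣ (Q ∣ R) ≡ₛ (P ∣ Q) ∣ R
  ≡-unit  : ∀ {P} → P ∣ 𝟘 ≡ₛ P

data Act : Set where
  act : Prefix → Act
  τ   : Act

data _—[_]→_ : Proc → Act → Proc → Set where
  pre  : ∀ {η P} → (η ∙ P) —[ act η ]→ P
  com  : ∀ {η P P' Q Q'} → P —[ act η ]→ P' → Q —[ act (co η) ]→ Q' →
         (P ∣ Q) —[ τ ]→ (P' ∣ Q')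
  parL : ∀ {μ P P' Q} → P —[ μ ]→ P' → (P ∣ Q) —[ μ ]→ (P' ∣ Q)
  parR : ∀ {μ P P' Q} → P —[ μ ]→ P' → (Q ∣ P) —[ μ ]→ (Q ∣ P')

Rel : Set₁
Rel = Proc → Proc → Set

IsSymmetric : Rel → Set
IsSymmetric R = ∀ {P Q} → R P Q → R Q P

IsSimulation : Rel → Set
IsSimulation R = ∀ {P Q μ P'} → R P Q → P —[ μ ]→ P' →
                 ∃[ Q' ] (Q —[ μ ]→ Q' × R P' Q')

infix 4 _∼_
_∼_ : Proc → Proc → Set₁
P ∼ Q = Σ Rel λ R → IsSymmetric R × IsSimulation R × R P Q

-- k-fold parallel composition, for k ≥ 1:  pow⁺ R k = R^(k+1)
-- R^1 = R,  R^(k+2) = R | R^(k+1)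
pow⁺ : Proc → ℕ → Proc
pow⁺ R zero    = R
pow⁺ R (suc k) = R ∣ pow⁺ R k

-- Replacing one subterm  η.(R | (η.R)^k)  (k ≥ 1) by  (η.R)^(k+1)
-- (k ≥ 1 is encoded as k = suc j, so (η.R)^k = pow⁺ (η.R) j).
data Rep : Proc → Proc → Set where
  here  : ∀ {η R} j → Rep (η ∙ (R ∣ pow⁺ (η ∙ R) j)) (pow⁺ (η ∙ R) (suc j))
  inPre : ∀ {η P P'} → Rep P P' → Rep (η ∙ P) (η ∙ P')
  inL   : ∀ {P P' Q} → Rep P P' → Rep (P ∣ Q) (P' ∣ Q)
  inR   : ∀ {P P' Q} → Rep P P' → Rep (Q ∣ P) (Q ∣ P')

infix 4 _→d_
_→d_ : Proc → Proc → Set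
P →d P' = ∃[ P₁ ] ∃[ P₂ ] (P ≡ₛ P₁ × Rep P₁ P₂ × P₂ ≡ₛ P')

NormalForm : Proc → Set
NormalForm P = ∀ P' → ¬ (P →d P')

{-# OPTIONS --safe #-}
-- Up to ≡ₛ a process is the bag of its components η ∙ X (X in a canonical form obtained by
-- sorting), and an η-move fires one component η ∙ X, replacing it by the components of X.
-- Induct on the size of A.  If A ∼ B, matching moves lead to bisimilar and hence (by induction)
-- congruent residuals, so every component of A has a partner in B with the same prefix, subject
-- to a bag identity, and conversely.  Suppose the bags differ, and take a component c = η ∙ X of
-- maximal size whose multiplicity differs, say with more copies in A.  Its partner d = η ∙ S is
-- no larger than c; firing any other component of A of size ≤ |c| would keep the surplus of c,
-- so there is none, and similarly every component of B smaller than c is d.  Comparing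
-- multiplicities then gives X ≡ₛ S ∣ dᵏ where B has k + 1 copies of d.  For k = 0 this makes
-- c = d, and for k ≥ 1 it makes c = η.(S ∣ (η.S)ᵏ) a →d-redex; both are impossible.
module Submission where

open import Defs

open import Data.Empty using (⊥; ⊥-elim)
open import Data.List using (List; []; _∷_; _++_; [_]; replicate; length; filter; foldr)
open import Data.List.Membership.Propositional using (_∈_; _∉_)
open import Data.List.Membership.Propositional.Properties using (∈-∃++; ∈-++⁻; ∈-++⁺ˡ; ∈-++⁺ʳ)
open import Data.List.Properties
  using (∷-injective; ++-assoc; ++-identityʳ; ≡-dec; length-++; filter-++; filter-accept; filter-reject;
         filter-none; filter-some)
open import Data.List.Relation.Binary.Permutation.Propositional
  using (_↭_; refl; prep; swap; trans; ↭-refl; ↭-sym; ↭-trans; ↭-reflexive; module PermutationReasoning)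
open import Data.List.Relation.Binary.Permutation.Propositional.Properties
  using (↭-length; filter-↭; shift; ++⁺; ++⁺ˡ; ++⁺ʳ; ++-comm)
import Data.List.Relation.Binary.Permutation.Propositional.Properties as ↭
open import Data.List.Relation.Binary.Pointwise using (Pointwise-≡⇒≡)
import Data.List.Relation.Binary.Pointwise as Pointwise
import Data.List.Relation.Binary.Lex.NonStrict as Lex
open import Data.List.Relation.Unary.All using (All; []; _∷_)
import Data.List.Relation.Unary.All as All
import Data.List.Relation.Unary.All.Properties as All
open import Data.List.Relation.Unary.Any using (here; there)
open import Data.Nat using (ℕ; zero; suc; _+_; _≤_; _<_; z≤n; s≤s; z<s; _≤?_)
import Data.Nat as ℕ
open import Data.Nat.Induction using (<-wellFounded)
open import Data.Nat.Properties
  using (≤-decTotalOrder; ≤-refl; ≤-trans; <-trans; ≤-<-trans; <-irrefl; <-cmp; <⇒≤; <⇒≢; >⇒≢; <⇒≱;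
         ≰⇒>; 1+n≢n; n<1+n; m≤m+n; m≤n+m; m≤n⇒m<n∨m≡n; suc-injective; +-comm; +-assoc;
         +-identityʳ; +-cancelˡ-≡; +-cancelʳ-≡; +-mono-<; +-monoˡ-<; +-monoʳ-<; module ≤-Reasoning)
open import Data.Product using (_×_; _,_; proj₁; proj₂; ∃-syntax)
open import Data.Sum using (inj₁; inj₂)
open import Function using (_∘_)
open import Induction.WellFounded using (Acc; acc)
open import Relation.Binary.Bundles using (DecTotalOrder)
import Relation.Binary.Construct.On as On
open import Relation.Binary.Definitions using (DecidableEquality; tri<; tri≈; tri>)
open import Relation.Binary.PropositionalEquality as ≡
  using (_≡_; _≢_; refl; sym; cong; cong₂; subst; module ≡-Reasoning)
open import Relation.Nullary using (¬_; yes; no; contradiction)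
open import Relation.Nullary.Decidable using (map′)

-- A prefix-free code; the lexicographic order on codes is the total order used to sort components.
encode : Proc → List ℕ
encode 𝟘           = 0 ∷ []
encode (inp a ∙ P) = 1 ∷ a ∷ encode P
encode (out a ∙ P) = 2 ∷ a ∷ encode P
encode (P ∣ Q)     = 3 ∷ encode P ++ encode Q

encode-++-injective : ∀ P Q {xs ys} → encode P ++ xs ≡ encode Q ++ ys → P ≡ Q × xs ≡ ys
encode-++-injective 𝟘 𝟘 eq = refl , proj₂ (∷-injective eq)
encode-++-injective (inp a ∙ P) (inp b ∙ Q) eq
  with refl , eq′ ← ∷-injective eq
  with refl , eq″ ← ∷-injective eq′
  with refl , refl ← encode-++-injective P Q eq″ = refl , refl
encode-++-injective (out a ∙ P) (out b ∙ Q) eq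
  with refl , eq′ ← ∷-injective eq
  with refl , eq″ ← ∷-injective eq′
  with refl , refl ← encode-++-injective P Q eq″ = refl , refl
encode-++-injective (P ∣ Q) (P′ ∣ Q′) {xs} {ys} eq
  with refl , eq′ ← ∷-injective eq
  with refl , eq″ ← encode-++-injective P P′
         (≡.trans (sym (++-assoc (encode P) _ xs)) (≡.trans eq′ (++-assoc (encode P′) _ ys)))
  with refl , refl ← encode-++-injective Q Q′ eq″ = refl , refl
encode-++-injective 𝟘           (inp _ ∙ _) ()
encode-++-injective 𝟘           (out _ ∙ _) ()
encode-++-injective 𝟘           (_ ∣ _)     ()
encode-++-injective (inp _ ∙ _) 𝟘           ()
encode-++-injective (inp _ ∙ _) (out _ ∙ _) ()
encode-++-injective (inp _ ∙ _) (_ ∣ _)     ()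
encode-++-injective (out _ ∙ _) 𝟘           ()
encode-++-injective (out _ ∙ _) (inp _ ∙ _) ()
encode-++-injective (out _ ∙ _) (_ ∣ _)     ()
encode-++-injective (_ ∣ _)     𝟘           ()
encode-++-injective (_ ∣ _)     (inp _ ∙ _) ()
encode-++-injective (_ ∣ _)     (out _ ∙ _) ()

encode-injective : ∀ {P Q} → encode P ≡ encode Q → P ≡ Q
encode-injective {P} {Q} eq = proj₁ (encode-++-injective P Q
  (≡.trans (++-identityʳ (encode P)) (≡.trans eq (sym (++-identityʳ (encode Q))))))

infix 4 _≟_
_≟_ : DecidableEquality Proc
P ≟ Q = map′ encode-injective (cong encode) (≡-dec ℕ._≟_ (encode P) (encode Q))

Proc-decTotalOrder : DecTotalOrder _ _ _
Proc-decTotalOrder = On.decTotalOrder (Lex.≤-decTotalOrder ≤-decTotalOrder) encode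

open import Data.List.Membership.DecPropositional _≟_ using (_∈?_)
open import Data.List.Sort.InsertionSort.Base Proc-decTotalOrder using (sort)
open import Data.List.Sort.InsertionSort.Properties Proc-decTotalOrder
  using (sort-↭; insert-cong; insert-swap-cong)
open DecTotalOrder Proc-decTotalOrder using (module Eq)
open import Data.List.Relation.Binary.Equality.Setoid Eq.setoid using (_≋_; ≋-refl; ≋-trans)

sort-↭⇒≋ : ∀ {xs ys} → xs ↭ ys → sort xs ≋ sort ys
sort-↭⇒≋ refl         = ≋-refl
sort-↭⇒≋ (prep x p)   = insert-cong Eq.refl (sort-↭⇒≋ p)
sort-↭⇒≋ (swap x y p) = insert-swap-cong Eq.refl Eq.refl (sort-↭⇒≋ p)
sort-↭⇒≋ (trans p q)  = ≋-trans (sort-↭⇒≋ p) (sort-↭⇒≋ q)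

sort-↭⇒≡ : ∀ {xs ys} → xs ↭ ys → sort xs ≡ sort ys
sort-↭⇒≡ p = Pointwise-≡⇒≡ (Pointwise.map (encode-injective ∘ Pointwise-≡⇒≡) (sort-↭⇒≋ p))

size : Proc → ℕ
size 𝟘       = 0
size (η ∙ P) = suc (size P)
size (P ∣ Q) = size P + size Q

size-≡ₛ : ∀ {P Q} → P ≡ₛ Q → size P ≡ size Q
size-≡ₛ ≡-refl                = refl
size-≡ₛ (≡-sym e)             = sym (size-≡ₛ e)
size-≡ₛ (≡-trans e f)         = ≡.trans (size-≡ₛ e) (size-≡ₛ f)
size-≡ₛ (≡-pre e)             = cong suc (size-≡ₛ e)
size-≡ₛ (≡-par e f)           = cong₂ _+_ (size-≡ₛ e) (size-≡ₛ f)
size-≡ₛ (≡-comm {P} {Q})      = +-comm (size P) (size Q)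
size-≡ₛ (≡-assoc {P} {Q} {R}) = sym (+-assoc (size P) (size Q) (size R))
size-≡ₛ (≡-unit {P})          = +-identityʳ (size P)

step-size : ∀ {P μ P′} → P —[ μ ]→ P′ → size P′ < size P
step-size pre              = n<1+n _
step-size (com t u)        = +-mono-< (step-size t) (step-size u)
step-size (parL {Q = Q} t) = +-monoˡ-< (size Q) (step-size t)
step-size (parR {Q = Q} t) = +-monoʳ-< (size Q) (step-size t)

par : List Proc → Proc
par = foldr _∣_ 𝟘

par-++ : ∀ xs ys → par (xs ++ ys) ≡ₛ par xs ∣ par ys
par-++ []       ys = ≡-trans (≡-sym ≡-unit) ≡-comm
par-++ (x ∷ xs) ys = ≡-trans (≡-par ≡-refl (par-++ xs ys)) ≡-assoc

↭⇒par-≡ₛ : ∀ {xs ys} → xs ↭ ys → par xs ≡ₛ par ys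
↭⇒par-≡ₛ refl         = ≡-refl
↭⇒par-≡ₛ (prep x p)   = ≡-par ≡-refl (↭⇒par-≡ₛ p)
↭⇒par-≡ₛ (swap x y p) = ≡-trans ≡-assoc (≡-trans (≡-par ≡-comm (↭⇒par-≡ₛ p)) (≡-sym ≡-assoc))
↭⇒par-≡ₛ (trans p q)  = ≡-trans (↭⇒par-≡ₛ p) (↭⇒par-≡ₛ q)

par-replicate : ∀ x j → par (replicate (suc j) x) ≡ₛ pow⁺ x j
par-replicate x zero    = ≡-unit
par-replicate x (suc j) = ≡-par ≡-refl (par-replicate x j)

∈-size : ∀ {z xs} → z ∈ xs → size z ≤ size (par xs)
∈-size (here refl)            = m≤m+n _ _
∈-size {xs = x ∷ _} (there p) = ≤-trans (∈-size p) (m≤n+m _ (size x))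

count : Proc → List Proc → ℕ
count z xs = length (filter (z ≟_) xs)

infix 4 _≐_
_≐_ : List Proc → List Proc → Set
xs ≐ ys = ∀ z → count z xs ≡ count z ys

count-++ : ∀ z xs ys → count z (xs ++ ys) ≡ count z xs + count z ys
count-++ z xs ys = ≡.trans (cong length (filter-++ (z ≟_) xs ys)) (length-++ (filter (z ≟_) xs))

count-∷-++ : ∀ z x xs ys → count z (x ∷ xs ++ ys) ≡ count z [ x ] + (count z xs + count z ys)
count-∷-++ z x xs ys = ≡.trans (count-++ z [ x ] (xs ++ ys)) (cong (count z [ x ] +_) (count-++ z xs ys))

count-↭ : ∀ z {xs ys} → xs ↭ ys → count z xs ≡ count z ys
count-↭ z p = ↭-length (filter-↭ (z ≟_) p)

count-self : ∀ x → count x [ x ] ≡ 1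
count-self x = cong length (filter-accept (x ≟_) refl)

count-≢ : ∀ {z x} → z ≢ x → count z [ x ] ≡ 0
count-≢ {z} z≢x = cong length (filter-reject (z ≟_) z≢x)

count-[]-size≢ : ∀ {z x} → size z ≢ size x → count z [ x ] ≡ 0
count-[]-size≢ {z} {x} ne = count-≢ {z} {x} (ne ∘ cong size)

∉⇒count≡0 : ∀ {z xs} → z ∉ xs → count z xs ≡ 0
∉⇒count≡0 {z} {xs} z∉xs = cong length (filter-none (z ≟_) (All.¬Any⇒All¬ xs z∉xs))

∈⇒count-pos : ∀ {z xs} → z ∈ xs → 0 < count z xs
∈⇒count-pos {z} = filter-some (z ≟_)

count-pos⇒∈ : ∀ {z xs} → 0 < count z xs → z ∈ xs
count-pos⇒∈ {z} {xs} pos with z ∈? xs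
... | yes z∈xs = z∈xs
... | no  z∉xs = contradiction (∉⇒count≡0 z∉xs) (>⇒≢ pos)

count-[]-pos⇒≡ : ∀ {z x} → 0 < count z [ x ] → z ≡ x
count-[]-pos⇒≡ {z} {x} pos with z ≟ x
... | yes z≡x = z≡x
... | no  z≢x = contradiction (count-≢ z≢x) (>⇒≢ pos)

count-replicate-self : ∀ x k → count x (replicate k x) ≡ k
count-replicate-self x zero    = refl
count-replicate-self x (suc k) =
  ≡.trans (count-++ x [ x ] (replicate k x)) (cong₂ _+_ (count-self x) (count-replicate-self x k))

count-replicate-≢ : ∀ {z x} k → z ≢ x → count z (replicate k x) ≡ 0
count-replicate-≢         zero    z≢x = refl
count-replicate-≢ {z} {x} (suc k) z≢x =
  ≡.trans (count-++ z [ x ] (replicate k x)) (cong₂ _+_ (count-≢ z≢x) (count-replicate-≢ k z≢x))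

count-large : ∀ {z} xs → size (par xs) < size z → count z xs ≡ 0
count-large {z} xs lt = ∉⇒count≡0 {z} {xs} (λ z∈xs → <⇒≱ lt (∈-size z∈xs))

≐⇒↭ : ∀ xs ys → xs ≐ ys → xs ↭ ys
≐⇒↭ []       []       _  = ↭-refl
≐⇒↭ []       (y ∷ ys) eq = contradiction (eq y) (<⇒≢ (∈⇒count-pos {y} {y ∷ ys} (here refl)))
≐⇒↭ (x ∷ xs) ys       eq
  with as , bs , refl ← ∈-∃++ (count-pos⇒∈ {x} {ys}
                            (subst (0 <_) (eq x) (∈⇒count-pos {x} {x ∷ xs} (here refl))))
  = ↭-trans (prep x (≐⇒↭ xs (as ++ bs) eq′)) (↭-sym (shift x as bs))
  where
  eq′ : xs ≐ as ++ bs
  eq′ z = +-cancelˡ-≡ (count z [ x ]) _ _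
    (≡.trans (sym (count-++ z [ x ] xs))
    (≡.trans (eq z)
    (≡.trans (count-↭ z (shift x as bs)) (count-++ z [ x ] (as ++ bs)))))

components : Proc → List Proc
canonical  : Proc → Proc
components 𝟘       = []
components (η ∙ P) = [ η ∙ canonical P ]
components (P ∣ Q) = components P ++ components Q
canonical P = par (sort (components P))

Canonical : Proc → Set
Canonical P = canonical P ≡ P

components-≡ₛ : ∀ P → P ≡ₛ par (components P)
canonical-≡ₛ  : ∀ P → P ≡ₛ canonical P
components-≡ₛ 𝟘       = ≡-refl
components-≡ₛ (η ∙ P) = ≡-trans (≡-pre (canonical-≡ₛ P)) (≡-sym ≡-unit)
components-≡ₛ (P ∣ Q) =
  ≡-trans (≡-par (components-≡ₛ P) (components-≡ₛ Q)) (≡-sym (par-++ (components P) (components Q)))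
canonical-≡ₛ P = ≡-trans (components-≡ₛ P) (↭⇒par-≡ₛ (↭-sym (sort-↭ (components P))))

≡ₛ⇒components-↭ : ∀ {P Q} → P ≡ₛ Q → components P ↭ components Q
canonical-cong  : ∀ {P Q} → P ≡ₛ Q → canonical P ≡ canonical Q
≡ₛ⇒components-↭ ≡-refl                = ↭-refl
≡ₛ⇒components-↭ (≡-sym e)             = ↭-sym (≡ₛ⇒components-↭ e)
≡ₛ⇒components-↭ (≡-trans e f)         = ↭-trans (≡ₛ⇒components-↭ e) (≡ₛ⇒components-↭ f)
≡ₛ⇒components-↭ (≡-pre {η} e)         = ↭-reflexive (cong (λ X → [ η ∙ X ]) (canonical-cong e))
≡ₛ⇒components-↭ (≡-par e f)           = ++⁺ (≡ₛ⇒components-↭ e) (≡ₛ⇒components-↭ f)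
≡ₛ⇒components-↭ (≡-comm {P} {Q})      = ++-comm (components P) (components Q)
≡ₛ⇒components-↭ (≡-assoc {P} {Q} {R}) = ↭-sym (↭.++-assoc (components P) (components Q) (components R))
≡ₛ⇒components-↭ (≡-unit {P})          = ↭.++-identityʳ (components P)
canonical-cong e = cong par (sort-↭⇒≡ (≡ₛ⇒components-↭ e))

components-↭⇒≡ₛ : ∀ {P Q} → components P ↭ components Q → P ≡ₛ Q
components-↭⇒≡ₛ {P} {Q} p =
  ≡-trans (components-≡ₛ P) (≡-trans (↭⇒par-≡ₛ p) (≡-sym (components-≡ₛ Q)))

canonical-canonical : ∀ P → Canonical (canonical P)
canonical-canonical P = canonical-cong (≡-sym (canonical-≡ₛ P))

canonical-unique : ∀ {P Q} → Canonical P → Canonical Q → components P ↭ components Q → P ≡ Q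
canonical-unique {P} {Q} P-can Q-can p =
  ≡.trans (sym P-can) (≡.trans (canonical-cong (components-↭⇒≡ₛ {P} {Q} p)) Q-can)

count-components-large : ∀ {z} P → size P < size z → count z (components P) ≡ 0
count-components-large P lt = count-large (components P) (subst (_< _) (size-≡ₛ (components-≡ₛ P)) lt)

frame-right : ∀ {A : Set} {c : A} {xs′} xs ys {zs} →
              c ∷ xs′ ↭ xs ++ zs → c ∷ xs′ ++ ys ↭ (xs ++ ys) ++ zs
frame-right {c = c} {xs′} xs ys {zs} p = begin
  (c ∷ xs′) ++ ys   ↭⟨ ++⁺ʳ ys p ⟩
  (xs ++ zs) ++ ys  ≡⟨ ++-assoc xs zs ys ⟩
  xs ++ zs ++ ys    ↭⟨ ++⁺ˡ xs (++-comm zs ys) ⟩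
  xs ++ ys ++ zs    ≡⟨ ++-assoc xs ys zs ⟨
  (xs ++ ys) ++ zs  ∎
  where open PermutationReasoning

frame-left : ∀ {A : Set} {c : A} {ys′} xs ys {zs} →
             c ∷ ys′ ↭ ys ++ zs → c ∷ xs ++ ys′ ↭ (xs ++ ys) ++ zs
frame-left {c = c} {ys′} xs ys {zs} p = begin
  c ∷ xs ++ ys′     ↭⟨ shift c xs ys′ ⟨
  xs ++ c ∷ ys′     ↭⟨ ++⁺ˡ xs p ⟩
  xs ++ ys ++ zs    ≡⟨ ++-assoc xs ys zs ⟨
  (xs ++ ys) ++ zs  ∎
  where open PermutationReasoning

component⇒step : ∀ A {η X} → η ∙ X ∈ components A →
                 ∃[ A′ ] (A —[ act η ]→ A′ × η ∙ X ∷ components A′ ↭ components A ++ components X)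
component⇒step (η ∙ P) (here refl) = P , pre , prep _ (≡ₛ⇒components-↭ (canonical-≡ₛ P))
component⇒step (P ∣ Q) c∈ with ∈-++⁻ (components P) c∈
... | inj₁ c∈P with P′ , t , p ← component⇒step P c∈P =
  P′ ∣ Q , parL t , frame-right (components P) (components Q) p
... | inj₂ c∈Q with Q′ , t , p ← component⇒step Q c∈Q =
  P ∣ Q′ , parR t , frame-left (components P) (components Q) p

step⇒component : ∀ {A η A′} → A —[ act η ]→ A′ →
                 ∃[ X ] (η ∙ X ∈ components A × η ∙ X ∷ components A′ ↭ components A ++ components X)
step⇒component (pre {P = P}) = canonical P , here refl , prep _ (≡ₛ⇒components-↭ (canonical-≡ₛ P))
step⇒component (parL {P = P} {Q = Q} t) with X , c∈ , p ← step⇒component t =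
  X , ∈-++⁺ˡ c∈ , frame-right (components P) (components Q) p
step⇒component (parR {P = P} {Q = Q} t) with X , c∈ , p ← step⇒component t =
  X , ∈-++⁺ʳ (components Q) c∈ , frame-left (components Q) (components P) p

-- HasRedex matches the →d-redex up to ≡ₛ, not syntactically as Rep does.
data HasRedex : Proc → Set where
  redex : ∀ {η R S} j → S ≡ₛ R ∣ pow⁺ (η ∙ R) j → HasRedex (η ∙ S)
  under : ∀ {η P} → HasRedex P → HasRedex (η ∙ P)
  left  : ∀ {P Q} → HasRedex P → HasRedex (P ∣ Q)
  right : ∀ {P Q} → HasRedex Q → HasRedex (P ∣ Q)

HasRedex-resp  : ∀ {P Q} → P ≡ₛ Q → HasRedex P → HasRedex Q
HasRedex-resp⁻ : ∀ {P Q} → P ≡ₛ Q → HasRedex Q → HasRedex P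
HasRedex-resp ≡-refl        r                 = r
HasRedex-resp (≡-sym e)     r                 = HasRedex-resp⁻ e r
HasRedex-resp (≡-trans e f) r                 = HasRedex-resp f (HasRedex-resp e r)
HasRedex-resp (≡-pre e)     (redex j s)       = redex j (≡-trans (≡-sym e) s)
HasRedex-resp (≡-pre e)     (under r)         = under (HasRedex-resp e r)
HasRedex-resp (≡-par e f)   (left r)          = left (HasRedex-resp e r)
HasRedex-resp (≡-par e f)   (right r)         = right (HasRedex-resp f r)
HasRedex-resp ≡-comm        (left r)          = right r
HasRedex-resp ≡-comm        (right r)         = left r
HasRedex-resp ≡-assoc       (left r)          = left (left r)
HasRedex-resp ≡-assoc       (right (left r))  = left (right r)
HasRedex-resp ≡-assoc       (right (right r)) = right r
HasRedex-resp ≡-unit        (left r)          = r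
HasRedex-resp⁻ ≡-refl        r                = r
HasRedex-resp⁻ (≡-sym e)     r                = HasRedex-resp e r
HasRedex-resp⁻ (≡-trans e f) r                = HasRedex-resp⁻ e (HasRedex-resp⁻ f r)
HasRedex-resp⁻ (≡-pre e)     (redex j s)      = redex j (≡-trans e s)
HasRedex-resp⁻ (≡-pre e)     (under r)        = under (HasRedex-resp⁻ e r)
HasRedex-resp⁻ (≡-par e f)   (left r)         = left (HasRedex-resp⁻ e r)
HasRedex-resp⁻ (≡-par e f)   (right r)        = right (HasRedex-resp⁻ f r)
HasRedex-resp⁻ ≡-comm        (left r)         = right r
HasRedex-resp⁻ ≡-comm        (right r)        = left r
HasRedex-resp⁻ ≡-assoc       (left (left r))  = left r
HasRedex-resp⁻ ≡-assoc       (left (right r)) = right (left r)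
HasRedex-resp⁻ ≡-assoc       (right r)        = right (right r)
HasRedex-resp⁻ ≡-unit        r                = left r

HasRedex⇒→d : ∀ {P} → HasRedex P → ∃[ P′ ] P →d P′
HasRedex⇒→d (redex j s) = _ , _ , _ , ≡-pre s , here j , ≡-refl
HasRedex⇒→d (under r) with _ , _ , _ , e , rep , e′ ← HasRedex⇒→d r =
  _ , _ , _ , ≡-pre e , inPre rep , ≡-pre e′
HasRedex⇒→d (left r) with _ , _ , _ , e , rep , e′ ← HasRedex⇒→d r =
  _ , _ , _ , ≡-par e ≡-refl , inL rep , ≡-par e′ ≡-refl
HasRedex⇒→d (right r) with _ , _ , _ , e , rep , e′ ← HasRedex⇒→d r =
  _ , _ , _ , ≡-par ≡-refl e , inR rep , ≡-par ≡-refl e′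

normalForm⇒¬HasRedex : ∀ {P} → NormalForm P → ¬ HasRedex P
normalForm⇒¬HasRedex nf r with P′ , P→P′ ← HasRedex⇒→d r = nf P′ P→P′

step-HasRedex : ∀ {P μ P′} → P —[ μ ]→ P′ → HasRedex P′ → HasRedex P
step-HasRedex pre       r         = under r
step-HasRedex (com t u) (left r)  = left (step-HasRedex t r)
step-HasRedex (com t u) (right r) = right (step-HasRedex u r)
step-HasRedex (parL t)  (left r)  = left (step-HasRedex t r)
step-HasRedex (parL t)  (right r) = right r
step-HasRedex (parR t)  (left r)  = left r
step-HasRedex (parR t)  (right r) = right (step-HasRedex t r)

data Component : Proc → Set where
  component : ∀ {η X} → Canonical X → ¬ HasRedex (η ∙ X) → Component (η ∙ X)

components-Component : ∀ {A} → ¬ HasRedex A → All Component (components A)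
components-Component {𝟘}     ¬r = []
components-Component {η ∙ P} ¬r =
  component (canonical-canonical P) (¬r ∘ HasRedex-resp (≡-pre (≡-sym (canonical-≡ₛ P)))) ∷ []
components-Component {P ∣ Q} ¬r =
  All.++⁺ (components-Component (¬r ∘ left)) (components-Component (¬r ∘ right))

-- Firing η ∙ X in M and η ∙ Y in N leaves the bags (M - η ∙ X) + components X and
-- (N - η ∙ Y) + components Y; balance says they are equal, with the subtractions moved across.
record Answer (M N : List Proc) (η : Prefix) (X : Proc) : Set where
  constructor answer
  field
    Y       : Proc
    Y∈N     : η ∙ Y ∈ N
    balance : η ∙ Y ∷ M ++ components X ↭ η ∙ X ∷ N ++ components Y

_⇉_ : List Proc → List Proc → Set
M ⇉ N = ∀ {η X} → η ∙ X ∈ M → Answer M N η X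

record Matching (M N : List Proc) : Set where
  field
    M⇉N          : M ⇉ N
    N⇉M          : N ⇉ M
    M-components : All Component M
    N-components : All Component N

Matching-sym : ∀ {M N} → Matching M N → Matching N M
Matching-sym μ = record
  { M⇉N = N⇉M ; N⇉M = M⇉N ; M-components = N-components ; N-components = M-components }
  where open Matching μ

module _ {M N η X} (a : Answer M N η X) where
  open Answer a

  balance-at : ∀ z → count z [ η ∙ Y ] + (count z M + count z (components X))
                   ≡ count z [ η ∙ X ] + (count z N + count z (components Y))
  balance-at z = ≡.trans (sym (count-∷-++ z _ M (components X)))
                (≡.trans (count-↭ z balance) (count-∷-++ z _ N (components Y)))

  balance-above : ∀ z → size X < size z → size Y < size z →
                  count z [ η ∙ Y ] + count z M ≡ count z [ η ∙ X ] + count z N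
  balance-above z X<z Y<z = begin
    count z [ η ∙ Y ] + count z M                             ≡⟨ cong (count z [ η ∙ Y ] +_) (drop M X X<z) ⟨
    count z [ η ∙ Y ] + (count z M + count z (components X))  ≡⟨ balance-at z ⟩
    count z [ η ∙ X ] + (count z N + count z (components Y))  ≡⟨ cong (count z [ η ∙ X ] +_) (drop N Y Y<z) ⟩
    count z [ η ∙ X ] + count z N                             ∎
    where
    open ≡-Reasoning
    drop : ∀ L P → size P < size z → count z L + count z (components P) ≡ count z L
    drop L P P<z = ≡.trans (cong (count z L +_) (count-components-large P P<z)) (+-identityʳ _)

AgreeFrom : ℕ → List Proc → List Proc → Set
AgreeFrom n M N = ∀ z → n ≤ size z → count z M ≡ count z N

AgreeFrom-sym : ∀ {n M N} → AgreeFrom n M N → AgreeFrom n N M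
AgreeFrom-sym agree z n≤z = sym (agree z n≤z)

answer-size : ∀ {m M N θ W} → AgreeFrom (suc m) M N → size (θ ∙ W) ≤ m →
              (a : Answer M N θ W) → size (θ ∙ Answer.Y a) ≤ m
answer-size {m} {M} {N} {θ} {W} agree θW≤m a with size (θ ∙ Answer.Y a) ≤? m
... | yes θT≤m = θT≤m
... | no  θT≰m = contradiction f-balance (1+n≢n)
  where
  f = θ ∙ Answer.Y a
  m<f : m < size f
  m<f = ≰⇒> θT≰m
  θW<f : size (θ ∙ W) < size f
  θW<f = ≤-<-trans θW≤m m<f
  f-balance : 1 + count f N ≡ 0 + count f N
  f-balance = begin
    1 + count f N                  ≡⟨ cong₂ _+_ (count-self f) (agree f m<f) ⟨
    count f [ f ] + count f M      ≡⟨ balance-above a f (<⇒≤ θW<f) (n<1+n _) ⟩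
    count f [ θ ∙ W ] + count f N  ≡⟨ cong (_+ count f N) (count-[]-size≢ {f} {θ ∙ W} (>⇒≢ θW<f)) ⟩
    0 + count f N                  ∎
    where open ≡-Reasoning

module Surplus {M N} (μ : Matching M N) {η X} (c∈M : η ∙ X ∈ M)
               (X-canonical : Canonical X) (¬redex : ¬ HasRedex (η ∙ X))
               (surplus : count (η ∙ X) N < count (η ∙ X) M)
               (agree : AgreeFrom (suc (size (η ∙ X))) M N) where
  open Matching μ

  c : Proc
  c = η ∙ X

  m : ℕ
  m = size c

  c-answer : Answer M N η X
  c-answer = M⇉N c∈M

  open Answer c-answer renaming (Y to S; Y∈N to d∈N)

  d : Proc
  d = η ∙ S

  d≤m : size d ≤ m
  d≤m = answer-size agree ≤-refl c-answer

  S-canonical : Canonical S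
  S-canonical with All.lookup N-components d∈N
  ... | component S-can _ = S-can

  c≢d : c ≢ d
  c≢d c≡d = <-irrefl (+-cancelˡ-≡ (count c [ c ]) _ _ (sym c-balance)) surplus
    where
    c-balance : count c [ c ] + count c M ≡ count c [ c ] + count c N
    c-balance = ≡.trans (cong (λ x → count c [ x ] + count c M) c≡d)
                        (balance-above c-answer c (n<1+n (size X)) d≤m)

  -- Firing p ≠ c in M and its partner in N would preserve the surplus of c.
  small∈M⇒≡c : ∀ {p} → p ∈ M → size p ≤ m → p ≡ c
  small∈M⇒≡c {p} p∈M p≤m with All.lookup M-components p∈M
  ... | component {θ} {W} _ _ with p ≟ c
  ...   | yes p≡c = p≡c
  ...   | no  p≢c = contradiction c-at-most (<⇒≱ surplus)
    where
    a = M⇉N p∈M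
    c-at-most : count c M ≤ count c N
    c-at-most = begin
      count c M                               ≤⟨ m≤n+m _ _ ⟩
      count c [ θ ∙ Answer.Y a ] + count c M  ≡⟨ balance-above a c p≤m (answer-size agree p≤m a) ⟩
      count c [ p ] + count c N               ≡⟨ cong (_+ count c N) (count-≢ {c} {p} (p≢c ∘ sym)) ⟩
      count c N                               ∎
      where open ≤-Reasoning

  -- Otherwise firing e and its partner would preserve the surplus of c.
  smaller-answered-by-c : ∀ {θ U} → size (θ ∙ U) < m → (a : Answer N M θ U) → c ≡ θ ∙ Answer.Y a
  smaller-answered-by-c {θ} {U} e<m a with c ≟ θ ∙ Answer.Y a
  ... | yes c≡θT = c≡θT
  ... | no  c≢θT = contradiction N≡M (<⇒≢ surplus)
    where
    T = Answer.Y a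
    N≡M : count c N ≡ count c M
    N≡M = begin
      count c N                          ≡⟨ cong (_+ count c N) (count-≢ {c} {θ ∙ T} c≢θT) ⟨
      count c [ θ ∙ T ] + count c N      ≡⟨ balance-above a c (<-trans (n<1+n _) e<m)
                                              (answer-size (AgreeFrom-sym {M = M} {N} agree) (<⇒≤ e<m) a) ⟩
      count c [ θ ∙ U ] + count c M      ≡⟨ cong (_+ count c M) (count-[]-size≢ {c} {θ ∙ U} (>⇒≢ e<m)) ⟩
      count c M                          ∎
      where open ≡-Reasoning

  -- Comparing the balance of e, answered by c, with that of c at e gives count e [ d ] > 0.
  smaller∈N⇒≡d : ∀ {e} → e ∈ N → size e < m → e ≡ d
  smaller∈N⇒≡d {e} e∈N e<m with All.lookup N-components e∈N
  ... | component {θ} {U} _ _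
    with a ← N⇉M e∈N
    with refl ← smaller-answered-by-c e<m a
    = count-[]-pos⇒≡ {e} {d} (subst (0 <_) (sym e-in-d) z<s)
    where
    open ≡-Reasoning
    A = count e M + count e (components X)
    e-in-N : count e N ≡ suc A
    e-in-N = begin
      count e N                                             ≡⟨ +-identityʳ _ ⟨
      count e N + 0                                         ≡⟨ cong (count e N +_) (count-components-large U (n<1+n _)) ⟨
      count e N + count e (components U)                    ≡⟨ cong (_+ (count e N + count e (components U)))
                                                                    (count-[]-size≢ {e} {c} (<⇒≢ e<m)) ⟨
      count e [ c ] + (count e N + count e (components U))  ≡⟨ balance-at a e ⟩
      count e [ e ] + A                                     ≡⟨ cong (_+ A) (count-self e) ⟩
      suc A                                                 ∎
    e-in-d : count e [ d ] ≡ suc (count e (components S))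
    e-in-d = +-cancelʳ-≡ A _ _ (begin
      count e [ d ] + A                                     ≡⟨ balance-at c-answer e ⟩
      count e [ c ] + (count e N + count e (components S))  ≡⟨ cong (_+ (count e N + count e (components S)))
                                                                    (count-[]-size≢ {e} {c} (<⇒≢ e<m)) ⟩
      count e N + count e (components S)                    ≡⟨ cong (_+ count e (components S)) e-in-N ⟩
      suc (A + count e (components S))                      ≡⟨ cong suc (+-comm A _) ⟩
      suc (count e (components S)) + A                      ∎)

  count-M-small : ∀ {z} → z ≢ c → size z ≤ m → count z M ≡ 0
  count-M-small {z} z≢c z≤m = ∉⇒count≡0 {z} {M} (λ z∈M → z≢c (small∈M⇒≡c z∈M z≤m))

  count-N-smaller : ∀ {z} → z ≢ d → size z < m → count z N ≡ 0
  count-N-smaller {z} z≢d z<m = ∉⇒count≡0 {z} {N} (λ z∈N → z≢d (smaller∈N⇒≡d z∈N z<m))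

  count-X-at-d : ∀ {k} → count d N ≡ suc k → count d (components X) ≡ k + count d (components S)
  count-X-at-d {k} d-in-N = suc-injective (begin
    suc (count d (components X))                          ≡⟨ cong₂ (λ i j → i + (j + count d (components X)))
                                                                   (count-self d) (count-M-small (c≢d ∘ sym) d≤m) ⟨
    count d [ d ] + (count d M + count d (components X))  ≡⟨ balance-at c-answer d ⟩
    count d [ c ] + (count d N + count d (components S))  ≡⟨ cong₂ (λ i j → i + (j + count d (components S)))
                                                                   (count-≢ {d} {c} (c≢d ∘ sym)) d-in-N ⟩
    suc (k + count d (components S))                      ∎)
    where open ≡-Reasoning

  count-X-smaller : ∀ {z} → z ≢ d → size z < m → count z (components X) ≡ count z (components S)
  count-X-smaller {z} z≢d z<m = begin
    count z (components X)                                ≡⟨ cong₂ (λ i j → i + (j + count z (components X)))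
                                                                   (count-≢ {z} {d} z≢d)
                                                                   (count-M-small (<⇒≢ z<m ∘ cong size) (<⇒≤ z<m)) ⟨
    count z [ d ] + (count z M + count z (components X))  ≡⟨ balance-at c-answer z ⟩
    count z [ c ] + (count z N + count z (components S))  ≡⟨ cong₂ (λ i j → i + (j + count z (components S)))
                                                                   (count-[]-size≢ {z} {c} (<⇒≢ z<m))
                                                                   (count-N-smaller z≢d z<m) ⟩
    count z (components S)                                ∎
    where open ≡-Reasoning

  X≐S++dᵏ : ∀ {k} → count d N ≡ suc k → components X ≐ components S ++ replicate k d
  X≐S++dᵏ {k} d-in-N z = ≡.trans (pointwise z) (sym (count-++ z (components S) (replicate k d)))
    where
    pointwise : ∀ z → count z (components X) ≡ count z (components S) + count z (replicate k d)
    pointwise z with z ≟ d | m ≤? size z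
    ... | yes refl | _        = ≡.trans (count-X-at-d d-in-N)
                                  (≡.trans (+-comm k _) (cong (_ +_) (sym (count-replicate-self d k))))
    ... | no z≢d   | yes m≤z  = ≡.trans (count-components-large X m≤z)
                                  (sym (cong₂ _+_ (count-components-large S (≤-trans d≤m m≤z))
                                                  (count-replicate-≢ k z≢d)))
    ... | no z≢d   | no m≰z   = ≡.trans (count-X-smaller z≢d (≰⇒> m≰z))
                                  (≡.trans (sym (+-identityʳ _)) (cong (_ +_) (sym (count-replicate-≢ k z≢d))))

  impossible : ⊥
  impossible with count d N in d-in-N | ∈⇒count-pos {d} {N} d∈N
  ... | suc zero    | _ = c≢d (cong (η ∙_) X≡S)
    where
    X≡S : X ≡ S
    X≡S = canonical-unique X-canonical S-canonical (≐⇒↭ (components X) (components S)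
            (λ z → ≡.trans (X≐S++dᵏ d-in-N z) (cong (count z) (++-identityʳ (components S)))))
  ... | suc (suc j) | _ = ¬redex (redex j X≡S∣dʲ)
    where
    X≡S∣dʲ : X ≡ₛ S ∣ pow⁺ d j
    X≡S∣dʲ = ≡-trans (components-≡ₛ X)
             (≡-trans (↭⇒par-≡ₛ (≐⇒↭ (components X) (components S ++ dʲ⁺¹) (X≐S++dᵏ d-in-N)))
             (≡-trans (par-++ (components S) dʲ⁺¹)
                      (≡-par (≡-sym (components-≡ₛ S)) (par-replicate d j))))
      where dʲ⁺¹ = replicate (suc j) d

no-surplus : ∀ {M N} c → Matching M N → AgreeFrom (suc (size c)) M N → ¬ count c N < count c M
no-surplus {M} c μ agree surplus with c∈M ← count-pos⇒∈ {c} {M} (≤-<-trans z≤n surplus)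
  with All.lookup (Matching.M-components μ) c∈M
... | component X-canonical ¬redex = Surplus.impossible μ c∈M X-canonical ¬redex surplus agree

agreeFrom-pred : ∀ {n M N} → Matching M N → AgreeFrom (suc n) M N → AgreeFrom n M N
agreeFrom-pred {M = M} {N} μ agree z n≤z with m≤n⇒m<n∨m≡n n≤z
... | inj₁ n<z = agree z n<z
... | inj₂ refl with <-cmp (count z M) (count z N)
...   | tri< M<N _ _ = ⊥-elim (no-surplus z (Matching-sym μ) (AgreeFrom-sym {M = M} {N} agree) M<N)
...   | tri≈ _ M≡N _ = M≡N
...   | tri> _ _ N<M = ⊥-elim (no-surplus z μ agree N<M)

agreeFrom-zero : ∀ {M N} → Matching M N → ∀ n → AgreeFrom n M N → AgreeFrom 0 M N
agreeFrom-zero μ zero    agree = agree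
agreeFrom-zero μ (suc n) agree = agreeFrom-zero μ n (agreeFrom-pred μ agree)

agreeFrom-large : ∀ M N → AgreeFrom (suc (size (par M) + size (par N))) M N
agreeFrom-large M N z large = ≡.trans (count-large M (≤-trans (s≤s (m≤m+n _ _)) large))
                                      (sym (count-large N (≤-trans (s≤s (m≤n+m _ _)) large)))

matching⇒≐ : ∀ {M N} → Matching M N → M ≐ N
matching⇒≐ {M} {N} μ z = agreeFrom-zero μ _ (agreeFrom-large M N) z z≤n

balance-of-firings : ∀ {A : Set} {c d : A} {xs′ ys′} xs us ys vs → c ∷ xs′ ↭ xs ++ us →
                     d ∷ ys′ ↭ ys ++ vs → xs′ ↭ ys′ → d ∷ xs ++ us ↭ c ∷ ys ++ vs
balance-of-firings {c = c} {d} {xs′} {ys′} xs us ys vs p q r = begin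
  d ∷ xs ++ us  ↭⟨ prep d (↭-sym p) ⟩
  d ∷ c ∷ xs′   ↭⟨ swap d c r ⟩
  c ∷ d ∷ ys′   ↭⟨ prep c q ⟩
  c ∷ ys ++ vs  ∎
  where open PermutationReasoning

simulation⇒⇉ : ∀ {R : Rel} {A B} → IsSimulation R → R A B →
               (∀ {η A′ B′} → A —[ act η ]→ A′ → B —[ act η ]→ B′ → R A′ B′ →
                  components A′ ↭ components B′) →
               components A ⇉ components B
simulation⇒⇉ {A = A} {B} sim r residuals {X = X} c∈A
  with A′ , A→A′ , A-firing ← component⇒step A c∈A
  with B′ , B→B′ , r′ ← sim r A→A′
  with Y , d∈B , B-firing ← step⇒component B→B′
  = answer Y d∈B (balance-of-firings (components A) (components X) (components B) (components Y)
                    A-firing B-firing (residuals A→A′ B→B′ r′))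

redex-free-bisimilar⇒≡ₛ : ∀ {A B} → Acc _<_ (size A) → ¬ HasRedex A → ¬ HasRedex B → A ∼ B → A ≡ₛ B
redex-free-bisimilar⇒≡ₛ {A} {B} (acc smaller) ¬rA ¬rB (R , R-sym , R-sim , r) =
  components-↭⇒≡ₛ (≐⇒↭ (components A) (components B) (matching⇒≐ matching))
  where
  ih : ∀ {η A′ B′} → A —[ act η ]→ A′ → B —[ act η ]→ B′ → R A′ B′ → A′ ≡ₛ B′
  ih A→A′ B→B′ r′ = redex-free-bisimilar⇒≡ₛ (smaller (step-size A→A′))
    (¬rA ∘ step-HasRedex A→A′) (¬rB ∘ step-HasRedex B→B′) (R , R-sym , R-sim , r′)
  matching : Matching (components A) (components B)
  matching = record
    { M⇉N          = simulation⇒⇉ R-sim r (λ A→A′ B→B′ → ≡ₛ⇒components-↭ ∘ ih A→A′ B→B′)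
    ; N⇉M          = simulation⇒⇉ R-sim (R-sym r)
                       (λ B→B′ A→A′ → ≡ₛ⇒components-↭ ∘ ≡-sym ∘ ih A→A′ B→B′ ∘ R-sym)
    ; M-components = components-Component ¬rA
    ; N-components = components-Component ¬rB
    }

lemma2p5 : (A B : Proc) → NormalForm A → NormalForm B → A ∼ B → A ≡ₛ B
lemma2p5 A B nfA nfB =
  redex-free-bisimilar⇒≡ₛ (<-wellFounded (size A)) (normalForm⇒¬HasRedex nfA) (normalForm⇒¬HasRedex nfB)
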